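{- Let $H$ be a square root of a graph $G$ that has no recognizable edges. Then every non-pendant edge of $H$ lies on a cycle of $H$ of length at most $6$.
   Context: All graphs are finite, simple and undirected. $N_G(u)$ is the open and $N_G[u]=N_G(u)\cup\{u\}$ the closed neighbourhood of $u$ in $G$. The square $H^2$ of $H$ has vertex set $V_H$, two distinct vertices adjacent iff their distance in $H$ is at most $2$; $H$ is a square root of $G$ if $H^2=G$. A pendant edge is an edge incident to a vertex of degree $1$. An edge $uv$ of $G$ is recognizable if: (a) $N_G(u)\cap N_G(v)$ has a partition $(X,Y)$ with $X=\{x_1,\dots,x_p\}$, $Y=\{y_1,\dots,y_q\}$, $p,q\ge1$, where $X$ and $Y$ are cliques in $G$; (b) $x_iy_j\notin E_G$ for all $i,j$; (c) for every $w\in N_G(u)\setminus N_G[v]$, $wy_j\notin E_G$ for all $j$, and for every $w\in N_G(v)\setminus N_G[u]$, $wx_i\notin E_G$ for all $i$; (d) every $w\in N_G(u)\setminus N_G[v]$ is adjacent in $G$ to some $x_i$, and every $w\in N_G(v)\setminus N_G[u]$ is adjacent in $G$ to some $y_j$. -}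

module Defs where

open import Data.Nat using (ℕ; zero; suc; _+_; _≤_)
open import Data.Nat.DivMod using (_mod_)
open import Data.Fin using (Fin; toℕ)
open import Data.Bool using (Bool; true; false; if_then_else_)
open import Data.List using (List; map; allFin)
open import Data.Nat.ListAction using (sum)
open import Data.Product using (Σ; ∃; _×_)
open import Data.Sum using (_⊎_)
open import Data.Empty using (⊥)
open import Relation.Nullary using (¬_)
open import Relation.Binary.PropositionalEquality using (_≡_; _≢_)
open import Function.Definitions using (Injective)
open import Function.Bundles using (_⇔_)

record Graph (n : ℕ) : Set where
  field
    adj    : Fin n → Fin n → Bool
    adj-sym : ∀ u v → adj u v ≡ adj v u
    adj-irr : ∀ u → adj u u ≡ false

open Graph public

Adj : ∀ {n} → Graph n → Fin n → Fin n → Set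
Adj G u v = adj G u v ≡ true

degree : ∀ {n} → Graph n → Fin n → ℕ
degree {n} G u = sum (map (λ w → if adj G u w then 1 else 0) (allFin n))

IsSquareRoot : ∀ {n} → Graph n → Graph n → Set
IsSquareRoot {n} H G =
  ∀ u v → Adj G u v ⇔ (u ≢ v × (Adj H u v ⊎ ∃ λ w → Adj H u w × Adj H w v))

IsPendantEdge : ∀ {n} → Graph n → Fin n → Fin n → Set
IsPendantEdge G u v = Adj G u v × (degree G u ≡ 1 ⊎ degree G v ≡ 1)

_∈'_ : ∀ {n} → Fin n → (Fin n → Bool) → Set
x ∈' X = X x ≡ true

IsClique : ∀ {n} → Graph n → (Fin n → Bool) → Set
IsClique G X = ∀ a b → a ∈' X → b ∈' X → a ≢ b → Adj G a b

PrivNbr : ∀ {n} → Graph n → Fin n → Fin n → Fin n → Set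
PrivNbr G u v w = Adj G u w × w ≢ v × ¬ Adj G v w

RecognizableWitness : ∀ {n} → Graph n → Fin n → Fin n →
                      (Fin n → Bool) → (Fin n → Bool) → Set
RecognizableWitness G u v X Y =
    (∀ w → (w ∈' X ⊎ w ∈' Y) ⇔ (Adj G u w × Adj G v w))
  × (∀ w → w ∈' X → w ∈' Y → ⊥)
  × (∃ λ x → x ∈' X) × (∃ λ y → y ∈' Y)
  × IsClique G X × IsClique G Y
  × (∀ x y → x ∈' X → y ∈' Y → ¬ Adj G x y)
  × (∀ w → PrivNbr G u v w → ∀ y → y ∈' Y → ¬ Adj G w y)
  × (∀ w → PrivNbr G v u w → ∀ x → x ∈' X → ¬ Adj G w x)
  × (∀ w → PrivNbr G u v w → ∃ λ x → x ∈' X × Adj G w x)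
  × (∀ w → PrivNbr G v u w → ∃ λ y → y ∈' Y × Adj G w y)

IsRecognizable : ∀ {n} → Graph n → Fin n → Fin n → Set
IsRecognizable G u v =
  Adj G u v × ∃ λ X → ∃ λ Y → RecognizableWitness G u v X Y

record Cycle {n} (G : Graph n) (j : ℕ) : Set where
  field
    vtx   : Fin (3 + j) → Fin n
    inj   : Injective _≡_ _≡_ vtx
    edges : ∀ i → Adj G (vtx i) (vtx ((suc (toℕ i)) mod (3 + j)))

open Cycle public

EdgeOnCycle : ∀ {n} {G : Graph n} {j} → Cycle G j → Fin n → Fin n → Set
EdgeOnCycle {j = j} C u v = ∃ λ i →
  let a = vtx C i ; b = vtx C ((suc (toℕ i)) mod (3 + j)) in
  (a ≡ u × b ≡ v) ⊎ (a ≡ v × b ≡ u)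

-- If no cycle of length at most 6 passes through the edge uv of H, then X = N_H(u) ∖ {v}
-- and Y = N_H(v) ∖ {u} witness that uv is recognizable in G = H²: a common G-neighbour of
-- u and v outside X ∪ Y, a G-edge between X and Y, or a private neighbour violating (c) or
-- (d) would each close a cycle of length at most 6 through uv in H.  Since short cycles
-- through uv are decidable in a finite graph, the dichotomy is constructive.

module Submission where

open import Defs
open import Data.Bool using (Bool; true; false; if_then_else_)
import Data.Bool as Bool
open import Data.Empty using (⊥; ⊥-elim)
open import Data.Fin using (Fin; zero; suc; toℕ; fromℕ; _≟_)
open import Data.Fin.Properties using (any?; toℕ-injective; toℕ-fromℕ; toℕ-fromℕ<; toℕ≤pred[n])
import Data.Fin.Properties as Finₚ
open import Data.List using (tabulate)
open import Data.List.Properties using (map-tabulate)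
open import Data.Nat using (ℕ; zero; suc; _+_; _≤_; _<_; _<?_; s≤s)
open import Data.Nat.DivMod using (_mod_; _%_; n%n≡0; m<n⇒m%n≡m)
open import Data.Nat.ListAction using (sum)
open import Data.Nat.Properties using (m≤n⇒m<n∨m≡n; suc-injective; anyUpTo?; +-monoʳ-≤)
open import Data.Product using (Σ; ∃; _×_; _,_; proj₁)
open import Data.Sum using (_⊎_; inj₁; inj₂)
open import Data.Vec using (Vec; []; _∷_; lookup)
open import Data.Vec.Relation.Unary.All using ([]; _∷_)
open import Data.Vec.Relation.Unary.AllPairs using ([]; _∷_; allPairs?)
open import Data.Vec.Relation.Unary.Linked using (Linked; []; [-]; _∷_; linked?)
open import Data.Vec.Relation.Unary.Unique.Propositional using (Unique)
open import Data.Vec.Relation.Unary.Unique.Propositional.Properties using (lookup-injective)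
open import Function using (_∘_; id)
open import Function.Bundles using (Equivalence; _⇔_; mk⇔)
open import Relation.Nullary using (¬_; Dec; yes; no; does; ¬?; _×-dec_; map′; contradiction)
open import Relation.Nullary.Decidable using (True; toWitness; dec-true; decidable-stable)
open import Relation.Unary using (Decidable)
open import Relation.Binary.PropositionalEquality
  using (_≡_; _≢_; refl; sym; trans; subst₂; cong; ≢-sym; module ≡-Reasoning)

private
  variable
    n : ℕ
    a b c d e f : Fin n

Adj? : (G : Graph n) → ∀ a b → Dec (Adj G a b)
Adj? G a b = adj G a b Bool.≟ true

Adj-sym : (G : Graph n) → ∀ {a b} → Adj G a b → Adj G b a
Adj-sym G {a} {b} = trans (adj-sym G b a)

Adj⇒≢ : (G : Graph n) → ∀ {a b} → Adj G a b → a ≢ b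
Adj⇒≢ G {a} ab refl with trans (sym (adj-irr G a)) ab
... | ()

Linked-lookup : ∀ {a ℓ} {A : Set a} {R : A → A → Set ℓ} {k} {xs : Vec A k} → Linked R xs →
                ∀ i j → toℕ j ≡ suc (toℕ i) → R (lookup xs i) (lookup xs j)
Linked-lookup {xs = _ ∷ _ ∷ _} (r ∷ _)  zero    (suc zero) _  = r
Linked-lookup                  (_ ∷ rs) (suc i) (suc j)    eq = Linked-lookup rs i j (suc-injective eq)

∃-Vec? : ∀ k {p} {P : Vec (Fin n) k → Set p} → Decidable P → Dec (∃ P)
∃-Vec? zero    P? = map′ ([] ,_) (λ { ([] , p) → p }) (P? [])
∃-Vec? (suc k) P? = map′ (λ (x , xs , p) → x ∷ xs , p) (λ { (x ∷ xs , p) → x , xs , p })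
                         (any? λ x → ∃-Vec? k (λ xs → P? (x ∷ xs)))

subset : {P : Fin n → Set} → Decidable P → Fin n → Bool
subset P? w = does (P? w)

∈-subset⁺ : {P : Fin n → Set} (P? : Decidable P) → ∀ {w} → P w → w ∈' subset P?
∈-subset⁺ P? {w} = dec-true (P? w)

∈-subset⁻ : {P : Fin n → Set} (P? : Decidable P) → ∀ {w} → w ∈' subset P? → P w
∈-subset⁻ P? {w} w∈ with P? w | w∈
... | yes p | _ = p
... | no _  | ()

NbrExcept : Graph n → Fin n → Fin n → Fin n → Set
NbrExcept G u v w = Adj G u w × w ≢ v

nbrExcept? : ∀ (G : Graph n) u v → Decidable (NbrExcept G u v)
nbrExcept? G u v w = Adj? G u w ×-dec ¬? (w ≟ v)

sum-tabulate-≡0 : ∀ {m} (g : Fin m → ℕ) → (∀ w → g w ≡ 0) → sum (tabulate g) ≡ 0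
sum-tabulate-≡0 {zero}  g g≡0 = refl
sum-tabulate-≡0 {suc m} g g≡0 rewrite g≡0 zero = sum-tabulate-≡0 (g ∘ suc) (g≡0 ∘ suc)

sum-tabulate-≡1 : ∀ {m} (g : Fin m → ℕ) v → g v ≡ 1 → (∀ w → w ≢ v → g w ≡ 0) →
                  sum (tabulate g) ≡ 1
sum-tabulate-≡1 g zero    g≡1 g≡0 rewrite g≡1 =
  cong suc (sum-tabulate-≡0 (g ∘ suc) (λ w → g≡0 (suc w) λ ()))
sum-tabulate-≡1 g (suc v) g≡1 g≡0 rewrite g≡0 zero (λ ()) =
  sum-tabulate-≡1 (g ∘ suc) v g≡1 (λ w w≢v → g≡0 (suc w) (w≢v ∘ Finₚ.suc-injective))

degree≡1 : ∀ (G : Graph n) {u v} → Adj G u v → (∀ w → Adj G u w → w ≡ v) → degree G u ≡ 1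
degree≡1 {n} G {u} {v} uv only-v =
  trans (cong sum (map-tabulate id indicator))
        (sum-tabulate-≡1 indicator v indicator-v indicator-≢v)
  where
  indicator : Fin n → ℕ
  indicator w = if adj G u w then 1 else 0
  indicator-v : indicator v ≡ 1
  indicator-v rewrite uv = refl
  indicator-≢v : ∀ w → w ≢ v → indicator w ≡ 0
  indicator-≢v w w≢v with adj G u w in uw
  ... | true  = contradiction (only-v w uw) w≢v
  ... | false = refl

another-neighbour : ∀ (G : Graph n) {u v} → Adj G u v → degree G u ≢ 1 → ∃ (NbrExcept G u v)
another-neighbour G {u} {v} uv deg≢1 with any? (nbrExcept? G u v)
... | yes found = found
... | no ∄w = contradiction (degree≡1 G uv only-v) deg≢1
  where
  only-v : ∀ w → Adj G u w → w ≡ v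
  only-v w uw = decidable-stable (w ≟ v) λ w≢v → ∄w (w , uw , w≢v)

IsCycle : ∀ {j} → Graph n → Vec (Fin n) (3 + j) → Set
IsCycle G xs = Unique xs × Linked (Adj G) xs × Adj G (lookup xs (fromℕ _)) (lookup xs zero)

isCycle? : ∀ {j} (G : Graph n) → Decidable (IsCycle {j = j} G)
isCycle? G xs = allPairs? (λ a b → ¬? (a ≟ b)) xs ×-dec linked? (Adj? G) xs ×-dec Adj? G _ _

IsCycle⇒Cycle : ∀ {j} {G : Graph n} {xs : Vec (Fin n) (3 + j)} → IsCycle G xs → Cycle G j
IsCycle⇒Cycle {n} {j} {G} {xs} (unique , linked , closing) = record
  { vtx = lookup xs ; inj = lookup-injective unique _ _ ; edges = adjacent-next }
  where
  next : Fin (3 + j) → Fin (3 + j)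
  next i = suc (toℕ i) mod (3 + j)
  adjacent-next : ∀ i → Adj G (lookup xs i) (lookup xs (next i))
  adjacent-next i with m≤n⇒m<n∨m≡n (toℕ≤pred[n] i)
  ... | inj₁ i<last = Linked-lookup linked i (next i)
          (trans (toℕ-fromℕ< _) (m<n⇒m%n≡m (s≤s i<last)))
  ... | inj₂ i≡last =
          subst₂ (Adj G) (cong (lookup xs) (sym i≡last′)) (cong (lookup xs) (sym next≡zero)) closing
    where
    open ≡-Reasoning
    i≡last′ : i ≡ fromℕ (2 + j)
    i≡last′ = toℕ-injective (trans i≡last (sym (toℕ-fromℕ _)))
    next≡zero : next i ≡ zero
    next≡zero = toℕ-injective (begin
      toℕ (next i)          ≡⟨ toℕ-fromℕ< _ ⟩
      suc (toℕ i) % (3 + j) ≡⟨ cong (λ m → suc m % (3 + j)) i≡last ⟩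
      (3 + j) % (3 + j)     ≡⟨ n%n≡0 (3 + j) ⟩
      0                     ∎)

module _ (G : Graph n) where

  private
    ends≢ : ∀ {x y} → Adj G x y → x ≢ y
    ends≢ = Adj⇒≢ G
    ends≢′ : ∀ {x y} → Adj G y x → x ≢ y
    ends≢′ yx = ≢-sym (Adj⇒≢ G yx)

  triangle : Adj G a b → Adj G b c → Adj G c a → IsCycle G (a ∷ b ∷ c ∷ [])
  triangle ab bc ca =
    ( (ends≢ ab ∷ ends≢′ ca ∷ [])
    ∷ (ends≢ bc ∷ [])
    ∷ [] ∷ [])
    , ab ∷ bc ∷ [-] , ca

  square : Adj G a b → Adj G b c → Adj G c d → Adj G d a → a ≢ c → b ≢ d →
           IsCycle G (a ∷ b ∷ c ∷ d ∷ [])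
  square ab bc cd da a≢c b≢d =
    ( (ends≢ ab ∷ a≢c ∷ ends≢′ da ∷ [])
    ∷ (ends≢ bc ∷ b≢d ∷ [])
    ∷ (ends≢ cd ∷ [])
    ∷ [] ∷ [])
    , ab ∷ bc ∷ cd ∷ [-] , da

  pentagon : Adj G a b → Adj G b c → Adj G c d → Adj G d e → Adj G e a →
             a ≢ c → a ≢ d → b ≢ d → b ≢ e → c ≢ e →
             IsCycle G (a ∷ b ∷ c ∷ d ∷ e ∷ [])
  pentagon ab bc cd de ea a≢c a≢d b≢d b≢e c≢e =
    ( (ends≢ ab ∷ a≢c ∷ a≢d ∷ ends≢′ ea ∷ [])
    ∷ (ends≢ bc ∷ b≢d ∷ b≢e ∷ [])
    ∷ (ends≢ cd ∷ c≢e ∷ [])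
    ∷ (ends≢ de ∷ [])
    ∷ [] ∷ [])
    , ab ∷ bc ∷ cd ∷ de ∷ [-] , ea

  hexagon : Adj G a b → Adj G b c → Adj G c d → Adj G d e → Adj G e f → Adj G f a →
            a ≢ c → a ≢ d → a ≢ e → b ≢ d → b ≢ e → b ≢ f → c ≢ e → c ≢ f → d ≢ f →
            IsCycle G (a ∷ b ∷ c ∷ d ∷ e ∷ f ∷ [])
  hexagon ab bc cd de ef fa a≢c a≢d a≢e b≢d b≢e b≢f c≢e c≢f d≢f =
    ( (ends≢ ab ∷ a≢c ∷ a≢d ∷ a≢e ∷ ends≢′ fa ∷ [])
    ∷ (ends≢ bc ∷ b≢d ∷ b≢e ∷ b≢f ∷ [])
    ∷ (ends≢ cd ∷ c≢e ∷ c≢f ∷ [])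
    ∷ (ends≢ de ∷ d≢f ∷ [])
    ∷ (ends≢ ef ∷ [])
    ∷ [] ∷ [])
    , ab ∷ bc ∷ cd ∷ de ∷ ef ∷ [-] , fa

CycleThrough : Graph n → Fin n → Fin n → ℕ → Set
CycleThrough {n} G u v j = ∃ λ (xs : Vec (Fin n) (1 + j)) → IsCycle G (u ∷ v ∷ xs)

CycleThrough⇒Cycle : ∀ {G : Graph n} {u v j} → CycleThrough G u v j →
                     Σ (Cycle G j) λ C → EdgeOnCycle C u v
CycleThrough⇒Cycle (_ , c) = IsCycle⇒Cycle c , zero , inj₁ (refl , refl)

cycleThrough? : ∀ (G : Graph n) u v j → Dec (CycleThrough G u v j)
cycleThrough? G u v j = ∃-Vec? (1 + j) (λ xs → isCycle? G (u ∷ v ∷ xs))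

ShortCycleThrough : Graph n → Fin n → Fin n → Set
ShortCycleThrough G u v = ∃ λ j → j < 4 × CycleThrough G u v j

shortCycleThrough? : ∀ (G : Graph n) u v → Dec (ShortCycleThrough G u v)
shortCycleThrough? G u v = anyUpTo? (cycleThrough? G u v) 4

module Square (H G : Graph n) (sq : IsSquareRoot H G) where

  G⇒H-dist≤2 : ∀ {a b} → Adj G a b → a ≢ b × (Adj H a b ⊎ ∃ λ w → Adj H a w × Adj H w b)
  G⇒H-dist≤2 = Equivalence.to (sq _ _)

  H⇒G : ∀ {a b} → Adj H a b → Adj G a b
  H⇒G ab = Equivalence.from (sq _ _) (Adj⇒≢ H ab , inj₁ ab)

  H²⇒G : ∀ {a w b} → a ≢ b → Adj H a w → Adj H w b → Adj G a b
  H²⇒G {w = w} a≢b aw wb = Equivalence.from (sq _ _) (a≢b , inj₂ (w , aw , wb))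

module _ (H G : Graph n) (sq : IsSquareRoot H G) {u v : Fin n} (uv : Adj H u v)
         (deg-u : degree H u ≢ 1) (deg-v : degree H v ≢ 1)
         (no-short : ¬ ShortCycleThrough H u v) where

  open Square H G sq

  X Y : Fin n → Bool
  X = subset (nbrExcept? H u v)
  Y = subset (nbrExcept? H v u)

  private
    -- j < 4 is discharged by evaluation, j being a literal at every use.
    no-cycle : ∀ {j} {xs : Vec (Fin n) (1 + j)} {_ : True (j <? 4)} → ¬ IsCycle H (u ∷ v ∷ xs)
    no-cycle {j} {xs} {j<4} c = no-short (j , toWitness j<4 , xs , c)

    vu : Adj H v u
    vu = Adj-sym H uv

    X⁻ : ∀ {w} → w ∈' X → NbrExcept H u v w
    X⁻ = ∈-subset⁻ (nbrExcept? H u v)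
    Y⁻ : ∀ {w} → w ∈' Y → NbrExcept H v u w
    Y⁻ = ∈-subset⁻ (nbrExcept? H v u)
    X⁺ : ∀ {w} → Adj H u w → w ≢ v → w ∈' X
    X⁺ uw w≢v = ∈-subset⁺ (nbrExcept? H u v) (uw , w≢v)
    Y⁺ : ∀ {w} → Adj H v w → w ≢ u → w ∈' Y
    Y⁺ vw w≢u = ∈-subset⁺ (nbrExcept? H v u) (vw , w≢u)

  common-neighbours : ∀ w → (w ∈' X ⊎ w ∈' Y) ⇔ (Adj G u w × Adj G v w)
  common-neighbours w = mk⇔ to from
    where
    to : w ∈' X ⊎ w ∈' Y → Adj G u w × Adj G v w
    to (inj₁ w∈X) with X⁻ w∈X
    ... | uw , w≢v = H⇒G uw , H²⇒G (≢-sym w≢v) vu uw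
    to (inj₂ w∈Y) with Y⁻ w∈Y
    ... | vw , w≢u = H²⇒G (≢-sym w≢u) uv vw , H⇒G vw
    from : Adj G u w × Adj G v w → w ∈' X ⊎ w ∈' Y
    from (Guw , Gvw) with G⇒H-dist≤2 Guw | G⇒H-dist≤2 Gvw
    ... | _ , inj₁ uw | v≢w , _ = inj₁ (X⁺ uw (≢-sym v≢w))
    ... | u≢w , _ | _ , inj₁ vw = inj₂ (Y⁺ vw (≢-sym u≢w))
    ... | u≢w , inj₂ (a , ua , aw) | v≢w , inj₂ (b , vb , bw) with a ≟ v | b ≟ u | a ≟ b
    ...   | yes refl | _        | _        = inj₂ (Y⁺ aw (≢-sym u≢w))
    ...   | no _     | yes refl | _        = inj₁ (X⁺ bw (≢-sym v≢w))
    ...   | no _     | no _     | yes refl = contradiction (triangle H uv vb (Adj-sym H ua)) no-cycle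
    ...   | no a≢v   | no b≢u   | no a≢b   = contradiction
            (pentagon H uv vb bw (Adj-sym H aw) (Adj-sym H ua)
                      (≢-sym b≢u) u≢w v≢w (≢-sym a≢v) (≢-sym a≢b))
            no-cycle

  X-Y-disjoint : ∀ w → w ∈' X → w ∈' Y → ⊥
  X-Y-disjoint w w∈X w∈Y =
    no-cycle (triangle H uv (proj₁ (Y⁻ w∈Y)) (Adj-sym H (proj₁ (X⁻ w∈X))))

  X-nonempty : ∃ λ x → x ∈' X
  X-nonempty with another-neighbour H uv deg-u
  ... | w , uw , w≢v = w , X⁺ uw w≢v

  Y-nonempty : ∃ λ y → y ∈' Y
  Y-nonempty with another-neighbour H vu deg-v
  ... | w , vw , w≢u = w , Y⁺ vw w≢u

  X-clique : IsClique G X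
  X-clique a b a∈X b∈X a≢b = H²⇒G a≢b (Adj-sym H (proj₁ (X⁻ a∈X))) (proj₁ (X⁻ b∈X))

  Y-clique : IsClique G Y
  Y-clique a b a∈Y b∈Y a≢b = H²⇒G a≢b (Adj-sym H (proj₁ (Y⁻ a∈Y))) (proj₁ (Y⁻ b∈Y))

  X-Y-nonadjacent : ∀ x y → x ∈' X → y ∈' Y → ¬ Adj G x y
  X-Y-nonadjacent x y x∈X y∈Y Gxy with X⁻ x∈X | Y⁻ y∈Y | G⇒H-dist≤2 Gxy
  ... | ux , x≢v | vy , y≢u | _ , inj₁ xy =
        no-cycle (square H uv vy (Adj-sym H xy) (Adj-sym H ux) (≢-sym y≢u) (≢-sym x≢v))
  ... | ux , x≢v | vy , y≢u | x≢y , inj₂ (c , xc , cy) with c ≟ u | c ≟ v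
  ...   | yes refl | _        = no-cycle (triangle H uv vy (Adj-sym H cy))
  ...   | no _     | yes refl = no-cycle (triangle H uv (Adj-sym H xc) (Adj-sym H ux))
  ...   | no c≢u   | no c≢v   =
        no-cycle (pentagon H uv vy (Adj-sym H cy) (Adj-sym H xc) (Adj-sym H ux)
                   (≢-sym y≢u) (≢-sym c≢u) (≢-sym c≢v) (≢-sym x≢v) (≢-sym x≢y))

  private-u-Y-nonadjacent : ∀ w → PrivNbr G u v w → ∀ y → y ∈' Y → ¬ Adj G w y
  private-u-Y-nonadjacent w (Guw , w≢v , ¬Gvw) y y∈Y Gwy
    with Y⁻ y∈Y | G⇒H-dist≤2 Gwy | G⇒H-dist≤2 Guw
  ... | vy , _ | _ , inj₁ wy | _ = ¬Gvw (H²⇒G (≢-sym w≢v) vy (Adj-sym H wy))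
  ... | _ | _ , inj₂ _ | _ , inj₁ uw = ¬Gvw (H²⇒G (≢-sym w≢v) vu uw)
  ... | vy , y≢u | w≢y , inj₂ (c , wc , cy) | u≢w , inj₂ (a , ua , aw)
    with a ≟ v | c ≟ v | c ≟ u | a ≟ y | a ≟ c
  ...   | yes refl | _ | _ | _ | _ = ¬Gvw (H⇒G aw)
  ...   | no _ | yes refl | _ | _ | _ = ¬Gvw (H⇒G (Adj-sym H wc))
  ...   | no _ | no _ | yes refl | _ | _ = no-cycle (triangle H uv vy (Adj-sym H cy))
  ...   | no _ | no _ | no _ | yes refl | _ = no-cycle (triangle H uv vy (Adj-sym H ua))
  ...   | no _ | no c≢v | no _ | no _ | yes refl =
        no-cycle (square H uv vy (Adj-sym H cy) (Adj-sym H ua) (≢-sym y≢u) (≢-sym c≢v))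
  ...   | no a≢v | no c≢v | no c≢u | no a≢y | no a≢c =
        no-cycle (hexagon H uv vy (Adj-sym H cy) (Adj-sym H wc) (Adj-sym H aw) (Adj-sym H ua)
                   (≢-sym y≢u) (≢-sym c≢u) u≢w (≢-sym c≢v) (≢-sym w≢v) (≢-sym a≢v)
                   (≢-sym w≢y) (≢-sym a≢y) (≢-sym a≢c))

  private-v-X-nonadjacent : ∀ w → PrivNbr G v u w → ∀ x → x ∈' X → ¬ Adj G w x
  private-v-X-nonadjacent w (Gvw , w≢u , ¬Guw) x x∈X Gwx
    with X⁻ x∈X | G⇒H-dist≤2 Gwx | G⇒H-dist≤2 Gvw
  ... | ux , _ | _ , inj₁ wx | _ = ¬Guw (H²⇒G (≢-sym w≢u) ux (Adj-sym H wx))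
  ... | _ | _ , inj₂ _ | _ , inj₁ vw = ¬Guw (H²⇒G (≢-sym w≢u) uv vw)
  ... | ux , x≢v | w≢x , inj₂ (c , wc , cx) | v≢w , inj₂ (b , vb , bw)
    with b ≟ u | c ≟ u | c ≟ v | b ≟ x | b ≟ c
  ...   | yes refl | _ | _ | _ | _ = ¬Guw (H⇒G bw)
  ...   | no _ | yes refl | _ | _ | _ = ¬Guw (H⇒G (Adj-sym H wc))
  ...   | no _ | no _ | yes refl | _ | _ = no-cycle (triangle H uv cx (Adj-sym H ux))
  ...   | no _ | no _ | no _ | yes refl | _ = no-cycle (triangle H uv vb (Adj-sym H ux))
  ...   | no _ | no c≢u | no _ | no _ | yes refl =
        no-cycle (square H uv vb cx (Adj-sym H ux) (≢-sym c≢u) (≢-sym x≢v))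
  ...   | no b≢u | no c≢u | no c≢v | no b≢x | no b≢c =
        no-cycle (hexagon H uv vb bw wc cx (Adj-sym H ux)
                   (≢-sym b≢u) (≢-sym w≢u) (≢-sym c≢u) v≢w (≢-sym c≢v) (≢-sym x≢v)
                   b≢c b≢x w≢x)

  private-u-X-adjacent : ∀ w → PrivNbr G u v w → ∃ λ x → x ∈' X × Adj G w x
  private-u-X-adjacent w (Guw , w≢v , ¬Gvw) with G⇒H-dist≤2 Guw
  ... | _ , inj₁ uw = contradiction (H²⇒G (≢-sym w≢v) vu uw) ¬Gvw
  ... | _ , inj₂ (a , ua , aw) with a ≟ v
  ...   | yes refl = contradiction (H⇒G aw) ¬Gvw
  ...   | no a≢v   = a , X⁺ ua a≢v , H⇒G (Adj-sym H aw)

  private-v-Y-adjacent : ∀ w → PrivNbr G v u w → ∃ λ y → y ∈' Y × Adj G w y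
  private-v-Y-adjacent w (Gvw , w≢u , ¬Guw) with G⇒H-dist≤2 Gvw
  ... | _ , inj₁ vw = contradiction (H²⇒G (≢-sym w≢u) uv vw) ¬Guw
  ... | _ , inj₂ (b , vb , bw) with b ≟ u
  ...   | yes refl = contradiction (H⇒G bw) ¬Guw
  ...   | no b≢u   = b , Y⁺ vb b≢u , H⇒G (Adj-sym H bw)

  ¬short-cycle⇒recognizable : IsRecognizable G u v
  ¬short-cycle⇒recognizable = H⇒G uv , X , Y ,
    common-neighbours , X-Y-disjoint , X-nonempty , Y-nonempty , X-clique , Y-clique ,
    X-Y-nonadjacent , private-u-Y-nonadjacent , private-v-X-nonadjacent ,
    private-u-X-adjacent , private-v-Y-adjacent

corollary1 : ∀ {n} (H G : Graph n) → IsSquareRoot H G →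
             (∀ u v → ¬ IsRecognizable G u v) →
             ∀ u v → Adj H u v → ¬ IsPendantEdge H u v →
             ∃ λ j → 3 + j ≤ 6 × Σ (Cycle H j) λ C → EdgeOnCycle C u v
corollary1 H G sq unrecognizable u v uv ¬pendant with shortCycleThrough? H u v
... | yes (j , j<4 , c) = j , +-monoʳ-≤ 2 j<4 , CycleThrough⇒Cycle c
... | no ¬short = ⊥-elim (unrecognizable u v
      (¬short-cycle⇒recognizable H G sq uv
         (¬pendant ∘ (uv ,_) ∘ inj₁) (¬pendant ∘ (uv ,_) ∘ inj₂) ¬short))
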